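{- $\mathbb{BT}1\cap\mathbb{SH}_c=\mathbb V(\bar{\mathbf 2})$.
   Context: A semi-Heyting algebra is an algebra $\langle A;\wedge,\vee,\to,0,1\rangle$ such that $\langle A;\wedge,\vee,0,1\rangle$ is a bounded lattice and the identities $x\wedge(x\to y)\approx x\wedge y$, $x\wedge(y\to z)\approx x\wedge((x\wedge y)\to(x\wedge z))$, $x\to x\approx1$ hold. Write $x^*:=x\to0$. $\mathbb{BT}1$ is the variety of semi-Heyting algebras satisfying $(x\to y)\to(x\to y^*)^*\approx1$; $\mathbb{SH}_c$ is the variety of semi-Heyting algebras satisfying $x\to y\approx y\to x$; $\mathbb V(\bar{\mathbf 2})$ is the variety generated by $\bar{\mathbf 2}$, the semi-Heyting algebra on the chain $0<1$ with $0\to0=1$, $0\to1=0$, $1\to0=0$, $1\to1=1$. -}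

module Defs where

import Level
open import Level using (Level; suc; _⊔_)
open import Data.Nat using (ℕ)
open import Data.Bool using (Bool; true; false; _∧_; _∨_)
open import Relation.Binary.PropositionalEquality using (_≡_; refl)
open import Algebra.Lattice.Structures using (IsLattice)
open import Data.Product using (_×_)
import Data.Bool.Properties as BP

record SemiHeyting (ℓ : Level) : Set (suc ℓ) where
  infixr 7 _⊓_
  infixr 6 _⊔'_
  infixr 5 _⇒_
  field
    Carrier   : Set ℓ
    _⊓_       : Carrier → Carrier → Carrier
    _⊔'_      : Carrier → Carrier → Carrier
    _⇒_       : Carrier → Carrier → Carrier
    𝟘 𝟙       : Carrier
    isLattice : IsLattice _≡_ _⊔'_ _⊓_
    𝟘-least   : ∀ x → x ⊔' 𝟘 ≡ x
    𝟙-greatest : ∀ x → x ⊓ 𝟙 ≡ x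
    sh1 : ∀ x y → x ⊓ (x ⇒ y) ≡ x ⊓ y
    sh2 : ∀ x y z → x ⊓ (y ⇒ z) ≡ x ⊓ ((x ⊓ y) ⇒ (x ⊓ z))
    sh3 : ∀ x → x ⇒ x ≡ 𝟙

  _* : Carrier → Carrier
  x * = x ⇒ 𝟘

BT1 : ∀ {ℓ} → SemiHeyting ℓ → Set ℓ
BT1 A = ∀ x y → (x ⇒ y) ⇒ ((x ⇒ (y *)) *) ≡ 𝟙
  where open SemiHeyting A

SHc : ∀ {ℓ} → SemiHeyting ℓ → Set ℓ
SHc A = ∀ x y → x ⇒ y ≡ y ⇒ x
  where open SemiHeyting A

data Term : Set where
  var       : ℕ → Term
  `0 `1     : Term
  _`∧_ _`∨_ _`→_ : Term → Term → Term

⟦_⟧ : ∀ {ℓ} (A : SemiHeyting ℓ) → Term → (ℕ → SemiHeyting.Carrier A) → SemiHeyting.Carrier A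
⟦ A ⟧ (var i) ρ = ρ i
⟦ A ⟧ `0 ρ = SemiHeyting.𝟘 A
⟦ A ⟧ `1 ρ = SemiHeyting.𝟙 A
⟦ A ⟧ (s `∧ t) ρ = SemiHeyting._⊓_ A (⟦ A ⟧ s ρ) (⟦ A ⟧ t ρ)
⟦ A ⟧ (s `∨ t) ρ = SemiHeyting._⊔'_ A (⟦ A ⟧ s ρ) (⟦ A ⟧ t ρ)
⟦ A ⟧ (s `→ t) ρ = SemiHeyting._⇒_ A (⟦ A ⟧ s ρ) (⟦ A ⟧ t ρ)

_⊨_≈_ : ∀ {ℓ} → SemiHeyting ℓ → Term → Term → Set ℓ
A ⊨ s ≈ t = ∀ ρ → ⟦ A ⟧ s ρ ≡ ⟦ A ⟧ t ρ

_⇒₂_ : Bool → Bool → Bool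
false ⇒₂ false = true
false ⇒₂ true  = false
true  ⇒₂ false = false
true  ⇒₂ true  = true

TwoBar : SemiHeyting Level.zero
TwoBar = record
  { Carrier = Bool ; _⊓_ = _∧_ ; _⊔'_ = _∨_ ; _⇒_ = _⇒₂_ ; 𝟘 = false ; 𝟙 = true
  ; isLattice = BP.∨-∧-isLattice ; 𝟘-least = BP.∨-identityʳ ; 𝟙-greatest = BP.∧-identityʳ
  ; sh1 = λ { false _ → refl ; true false → refl ; true true → refl }
  ; sh2 = λ { false _ _ → refl ; true false false → refl ; true false true → refl
            ; true true false → refl ; true true true → refl }
  ; sh3 = λ { false → refl ; true → refl } }

-- Membership in V(2̄), the variety generated by 2̄: A satisfies every
-- identity that holds in 2̄ (the equational class Mod(Id(2̄)) = HSP(2̄)).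
InV2̄ : ∀ {ℓ} → SemiHeyting ℓ → Set ℓ
InV2̄ A = ∀ s t → TwoBar ⊨ s ≈ t → A ⊨ s ≈ t

{-# OPTIONS --safe #-}
-- A semi-Heyting algebra in which every element is complemented and 𝟘 ⇒ 𝟙 ≡ 𝟘
-- satisfies every identity of 2̄: {𝟘, 𝟙} is then a copy of 2̄, and since x ↦ a ⊓ x
-- respects all operations (by sh2), the value of a term below a depends only on the
-- values of its variables below a; splitting along ρ k ⊔ ρ k * ≡ 𝟙 thus replaces the
-- variables one at a time by 𝟙 or 𝟘. In BT1 ∩ SHc commutativity gives 𝟘 ⇒ 𝟙 ≡ 𝟙 ⇒ 𝟘 ≡ 𝟘
-- and d ⇒ 𝟙 ≡ d, so BT1 at x = 𝟙 forces every dense element (d * ≡ 𝟘) to be 𝟙, and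
-- x ⊔ x * is dense in any semi-Heyting algebra. Conversely, both identities hold in 2̄.
module Submission where

open import Defs
open import Data.Product using (_×_; _,_; Σ; proj₁; proj₂)
open import Function.Bundles using (_⇔_; mk⇔)
open import Level using (Level)
open import Data.Nat using (ℕ; zero; suc; _<_; z≤n; _≟_; _<?_) renaming (_⊔_ to _⊔ₙ_; _≤_ to _≤ₙ_)
open import Data.Nat.Properties using (m<n⇒m<n⊔o; m<n⇒m<o⊔n; n<1+n; ≤∧≢⇒<; <⇒≱)
open import Data.Bool using (Bool; true; false; _∧_; _∨_)
open import Data.Empty using (⊥-elim)
open import Relation.Nullary using (yes; no)
open import Relation.Binary.PropositionalEquality using (_≡_; refl; sym; trans; cong; cong₂; module ≡-Reasoning)
open import Algebra.Bundles using (CommutativeSemigroup)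
open import Algebra.Lattice.Bundles using (Lattice)
import Algebra.Lattice.Properties.Lattice as LatticeProperties
import Algebra.Properties.CommutativeSemigroup as CommutativeSemigroupProperties
import Relation.Binary.Lattice as OrderLattice
import Relation.Binary.Lattice.Properties.MeetSemilattice as MeetSemilatticeProperties
import Relation.Binary.Reasoning.PartialOrder as ≤-Reasoning

varBound : Term → ℕ
varBound (var i)  = suc i
varBound `0       = 0
varBound `1       = 0
varBound (s `∧ t) = varBound s ⊔ₙ varBound t
varBound (s `∨ t) = varBound s ⊔ₙ varBound t
varBound (s `→ t) = varBound s ⊔ₙ varBound t

module _ {p} {P : ℕ → Set p} (m n : ℕ) where

  restrict-⊔ˡ : (∀ j → j < m ⊔ₙ n → P j) → ∀ j → j < m → P j
  restrict-⊔ˡ f j j<m = f j (m<n⇒m<n⊔o n j<m)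

  restrict-⊔ʳ : (∀ j → j < m ⊔ₙ n → P j) → ∀ j → j < n → P j
  restrict-⊔ʳ f j j<n = f j (m<n⇒m<o⊔n m j<n)

_[_≔_] : ∀ {a} {X : Set a} → (ℕ → X) → ℕ → X → ℕ → X
(ρ [ k ≔ x ]) j with j ≟ k
... | yes _ = x
... | no  _ = ρ j

module SemiHeytingProperties {ℓ : Level} (A : SemiHeyting ℓ) where
  open SemiHeyting A

  lattice : Lattice ℓ ℓ
  lattice = record { isLattice = isLattice }

  open Lattice lattice using (∧-comm; ∧-assoc; ∨-comm; ∧-absorbs-∨; ∨-absorbs-∧)
  open LatticeProperties lattice using (∧-idem; ∧-isSemigroup; ∨-∧-orderTheoreticLattice)
  -- x ≤ y unfolds to x ≡ x ⊓ y.
  open OrderLattice.Lattice ∨-∧-orderTheoreticLattice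
    using (_≤_; poset; antisym; ≤-respˡ-≈; x≤x∨y; y≤x∨y; ∨-least; x∧y≤y; ∧-greatest; meetSemilattice)
    renaming (refl to ≤-refl)
  open MeetSemilatticeProperties meetSemilattice using (∧-monotonic)

  ∧-commutativeSemigroup : CommutativeSemigroup ℓ ℓ
  ∧-commutativeSemigroup = record
    { isCommutativeSemigroup = record { isSemigroup = ∧-isSemigroup ; comm = ∧-comm } }

  open CommutativeSemigroupProperties ∧-commutativeSemigroup using (interchange)

  ∧-identityˡ : ∀ x → 𝟙 ⊓ x ≡ x
  ∧-identityˡ x = trans (∧-comm 𝟙 x) (𝟙-greatest x)

  ∨-identityˡ : ∀ x → 𝟘 ⊔' x ≡ x
  ∨-identityˡ x = trans (∨-comm 𝟘 x) (𝟘-least x)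

  ∧-zeroˡ : ∀ x → 𝟘 ⊓ x ≡ 𝟘
  ∧-zeroˡ x = trans (cong (𝟘 ⊓_) (sym (∨-identityˡ x))) (∧-absorbs-∨ 𝟘 x)

  ∧-zeroʳ : ∀ x → x ⊓ 𝟘 ≡ 𝟘
  ∧-zeroʳ x = trans (∧-comm x 𝟘) (∧-zeroˡ x)

  ∨-zeroˡ : ∀ x → 𝟙 ⊔' x ≡ 𝟙
  ∨-zeroˡ x = trans (cong (𝟙 ⊔'_) (sym (∧-identityˡ x))) (∨-absorbs-∧ 𝟙 x)

  ≤𝟘⇒≡𝟘 : ∀ {x} → x ≤ 𝟘 → x ≡ 𝟘
  ≤𝟘⇒≡𝟘 {x} x≤𝟘 = trans x≤𝟘 (∧-zeroʳ x)

  ∧-distribˡ-∧ : ∀ x y z → x ⊓ (y ⊓ z) ≡ (x ⊓ y) ⊓ (x ⊓ z)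
  ∧-distribˡ-∧ x y z = trans (cong (_⊓ (y ⊓ z)) (sym (∧-idem x))) (interchange x x y z)

  ⇒-identityˡ : ∀ x → 𝟙 ⇒ x ≡ x
  ⇒-identityˡ x = begin
    𝟙 ⇒ x        ≡⟨ sym (∧-identityˡ (𝟙 ⇒ x)) ⟩
    𝟙 ⊓ (𝟙 ⇒ x)  ≡⟨ sh1 𝟙 x ⟩
    𝟙 ⊓ x        ≡⟨ ∧-identityˡ x ⟩
    x            ∎
    where open ≡-Reasoning

  ≤-⇒-∧ : ∀ {x y z} → z ⊓ x ≤ y → z ≤ x ⇒ x ⊓ y
  ≤-⇒-∧ {x} {y} {z} z⊓x≤y = sym (begin
    z ⊓ (x ⇒ x ⊓ y)                ≡⟨ sh2 z x (x ⊓ y) ⟩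
    z ⊓ (z ⊓ x ⇒ z ⊓ (x ⊓ y))      ≡⟨ cong (λ w → z ⊓ (z ⊓ x ⇒ w)) (sym (∧-assoc z x y)) ⟩
    z ⊓ (z ⊓ x ⇒ (z ⊓ x) ⊓ y)      ≡⟨ cong (λ w → z ⊓ (z ⊓ x ⇒ w)) (sym z⊓x≤y) ⟩
    z ⊓ (z ⊓ x ⇒ z ⊓ x)            ≡⟨ cong (z ⊓_) (sh3 (z ⊓ x)) ⟩
    z ⊓ 𝟙                          ≡⟨ 𝟙-greatest z ⟩
    z                              ∎)
    where open ≡-Reasoning

  -- Although x ⇒ _ need not be a residual, both y and z lie below x ⇒ x ⊓ m.
  ∧-distribˡ-∨ : ∀ x y z → x ⊓ (y ⊔' z) ≡ x ⊓ y ⊔' x ⊓ z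
  ∧-distribˡ-∨ x y z = antisym ≤-distrib ≥-distrib
    where
    open ≤-Reasoning poset
    m : Carrier
    m = x ⊓ y ⊔' x ⊓ z
    ≤-distrib : x ⊓ (y ⊔' z) ≤ m
    ≤-distrib = begin
      x ⊓ (y ⊔' z)       ≤⟨ ∧-monotonic ≤-refl (∨-least (≤-⇒-∧ y⊓x≤m) (≤-⇒-∧ z⊓x≤m)) ⟩
      x ⊓ (x ⇒ x ⊓ m)    ≡⟨ sh1 x (x ⊓ m) ⟩
      x ⊓ (x ⊓ m)        ≤⟨ x∧y≤y _ _ ⟩
      x ⊓ m              ≤⟨ x∧y≤y _ _ ⟩
      m                  ∎
      where
      y⊓x≤m : y ⊓ x ≤ m
      y⊓x≤m = ≤-respˡ-≈ (∧-comm x y) (x≤x∨y _ _)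
      z⊓x≤m : z ⊓ x ≤ m
      z⊓x≤m = ≤-respˡ-≈ (∧-comm x z) (y≤x∨y _ _)
    ≥-distrib : m ≤ x ⊓ (y ⊔' z)
    ≥-distrib = ∨-least (∧-monotonic ≤-refl (x≤x∨y y z)) (∧-monotonic ≤-refl (y≤x∨y y z))

  infix 4 _≡[_]_
  _≡[_]_ : Carrier → Carrier → Carrier → Set ℓ
  x ≡[ a ] y = a ⊓ x ≡ a ⊓ y

  ≡-by-cases : ∀ {a b x y} → a ⊔' b ≡ 𝟙 → x ≡[ a ] y → x ≡[ b ] y → x ≡ y
  ≡-by-cases {a} {b} {x} {y} a⊔b≡𝟙 a⊓x≡a⊓y b⊓x≡b⊓y = begin
    x                  ≡⟨ split x ⟩
    a ⊓ x ⊔' b ⊓ x     ≡⟨ cong₂ _⊔'_ a⊓x≡a⊓y b⊓x≡b⊓y ⟩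
    a ⊓ y ⊔' b ⊓ y     ≡⟨ sym (split y) ⟩
    y                  ∎
    where
    open ≡-Reasoning
    split : ∀ w → w ≡ a ⊓ w ⊔' b ⊓ w
    split w = begin
      w                  ≡⟨ sym (𝟙-greatest w) ⟩
      w ⊓ 𝟙              ≡⟨ cong (w ⊓_) (sym a⊔b≡𝟙) ⟩
      w ⊓ (a ⊔' b)       ≡⟨ ∧-distribˡ-∨ w a b ⟩
      w ⊓ a ⊔' w ⊓ b     ≡⟨ cong₂ _⊔'_ (∧-comm w a) (∧-comm w b) ⟩
      a ⊓ w ⊔' b ⊓ w     ∎

  x⊓x*≡𝟘 : ∀ x → x ⊓ x * ≡ 𝟘
  x⊓x*≡𝟘 x = trans (sh1 x 𝟘) (∧-zeroʳ x)

  ⊓≡𝟘⇒≤* : ∀ {w x} → w ⊓ x ≡ 𝟘 → w ≤ x *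
  ⊓≡𝟘⇒≤* {w} {x} w⊓x≡𝟘 = sym (begin
    w ⊓ (x ⇒ 𝟘)              ≡⟨ sh2 w x 𝟘 ⟩
    w ⊓ (w ⊓ x ⇒ w ⊓ 𝟘)      ≡⟨ cong₂ (λ u v → w ⊓ (u ⇒ v)) w⊓x≡𝟘 (∧-zeroʳ w) ⟩
    w ⊓ (𝟘 ⇒ 𝟘)              ≡⟨ cong (w ⊓_) (sh3 𝟘) ⟩
    w ⊓ 𝟙                    ≡⟨ 𝟙-greatest w ⟩
    w                        ∎)
    where open ≡-Reasoning

  [x⊔x*]*≡𝟘 : ∀ x → (x ⊔' x *) * ≡ 𝟘
  [x⊔x*]*≡𝟘 x = ≤𝟘⇒≡𝟘 (begin
    w                ≤⟨ ∧-greatest ≤-refl (⊓≡𝟘⇒≤* w⊓x≡𝟘) ⟩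
    w ⊓ x *          ≤⟨ ∧-monotonic ≤-refl (y≤x∨y x (x *)) ⟩
    w ⊓ (x ⊔' x *)   ≡⟨ w⊓[x⊔x*]≡𝟘 ⟩
    𝟘                ∎)
    where
    open ≤-Reasoning poset
    w : Carrier
    w = (x ⊔' x *) *
    w⊓[x⊔x*]≡𝟘 : w ⊓ (x ⊔' x *) ≡ 𝟘
    w⊓[x⊔x*]≡𝟘 = trans (∧-comm w (x ⊔' x *)) (x⊓x*≡𝟘 (x ⊔' x *))
    w⊓x≡𝟘 : w ⊓ x ≡ 𝟘
    w⊓x≡𝟘 = ≤𝟘⇒≡𝟘 (begin
      w ⊓ x            ≤⟨ ∧-monotonic ≤-refl (x≤x∨y x (x *)) ⟩
      w ⊓ (x ⊔' x *)   ≡⟨ w⊓[x⊔x*]≡𝟘 ⟩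
      𝟘                ∎)

  ≡[]-cong₂ : ∀ {a} {_∙_ : Carrier → Carrier → Carrier} (G : Carrier → Carrier → Carrier) →
              (∀ u v → a ⊓ (u ∙ v) ≡ G (a ⊓ u) (a ⊓ v)) →
              ∀ {u u' v v'} → u ≡[ a ] u' → v ≡[ a ] v' → u ∙ v ≡[ a ] u' ∙ v'
  ≡[]-cong₂ G distrib {u} {u'} {v} {v'} u≡u' v≡v' =
    trans (distrib u v) (trans (cong₂ G u≡u' v≡v') (sym (distrib u' v')))

  ⟦⟧-cong-≡[] : ∀ a t {ρ ρ'} → (∀ j → j < varBound t → ρ j ≡[ a ] ρ' j) →
                ⟦ A ⟧ t ρ ≡[ a ] ⟦ A ⟧ t ρ'
  ⟦⟧-cong-≡[] a (var i) eq  = eq i (n<1+n i)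
  ⟦⟧-cong-≡[] a `0 eq       = refl
  ⟦⟧-cong-≡[] a `1 eq       = refl
  ⟦⟧-cong-≡[] a (s `∧ t) eq = ≡[]-cong₂ _⊓_ (∧-distribˡ-∧ a)
    (⟦⟧-cong-≡[] a s (restrict-⊔ˡ _ _ eq)) (⟦⟧-cong-≡[] a t (restrict-⊔ʳ _ _ eq))
  ⟦⟧-cong-≡[] a (s `∨ t) eq = ≡[]-cong₂ _⊔'_ (∧-distribˡ-∨ a)
    (⟦⟧-cong-≡[] a s (restrict-⊔ˡ _ _ eq)) (⟦⟧-cong-≡[] a t (restrict-⊔ʳ _ _ eq))
  ⟦⟧-cong-≡[] a (s `→ t) eq = ≡[]-cong₂ (λ u v → a ⊓ (u ⇒ v)) (sh2 a)
    (⟦⟧-cong-≡[] a s (restrict-⊔ˡ _ _ eq)) (⟦⟧-cong-≡[] a t (restrict-⊔ʳ _ _ eq))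

  ⟦⟧-cong : ∀ t {ρ ρ'} → (∀ j → j < varBound t → ρ j ≡ ρ' j) → ⟦ A ⟧ t ρ ≡ ⟦ A ⟧ t ρ'
  ⟦⟧-cong t {ρ} {ρ'} eq = begin
    ⟦ A ⟧ t ρ          ≡⟨ sym (∧-identityˡ _) ⟩
    𝟙 ⊓ ⟦ A ⟧ t ρ      ≡⟨ ⟦⟧-cong-≡[] 𝟙 t (λ j j<t → cong (𝟙 ⊓_) (eq j j<t)) ⟩
    𝟙 ⊓ ⟦ A ⟧ t ρ'     ≡⟨ ∧-identityˡ _ ⟩
    ⟦ A ⟧ t ρ'         ∎
    where open ≡-Reasoning

  ≡[]-update : ∀ {a ρ k x} → ρ k ≡[ a ] x → ∀ j → ρ j ≡[ a ] (ρ [ k ≔ x ]) j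
  ≡[]-update {k = k} ρk≡x j with j ≟ k
  ... | yes refl = ρk≡x
  ... | no  _    = refl

  x≡[x]𝟙 : ∀ x → x ≡[ x ] 𝟙
  x≡[x]𝟙 x = trans (∧-idem x) (sym (𝟙-greatest x))

  x≡[x*]𝟘 : ∀ x → x ≡[ x * ] 𝟘
  x≡[x*]𝟘 x = trans (∧-comm (x *) x) (trans (x⊓x*≡𝟘 x) (sym (∧-zeroʳ (x *))))

  fromBool : Bool → Carrier
  fromBool true  = 𝟙
  fromBool false = 𝟘

  fromBool-⊓ : ∀ b c → fromBool b ⊓ fromBool c ≡ fromBool (b ∧ c)
  fromBool-⊓ true  c = ∧-identityˡ (fromBool c)
  fromBool-⊓ false c = ∧-zeroˡ (fromBool c)

  fromBool-⊔ : ∀ b c → fromBool b ⊔' fromBool c ≡ fromBool (b ∨ c)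
  fromBool-⊔ true  c = ∨-zeroˡ (fromBool c)
  fromBool-⊔ false c = ∨-identityˡ (fromBool c)

  module _ (𝟘⇒𝟙≡𝟘 : 𝟘 ⇒ 𝟙 ≡ 𝟘) where

    fromBool-⇒ : ∀ b c → fromBool b ⇒ fromBool c ≡ fromBool (b ⇒₂ c)
    fromBool-⇒ false false = sh3 𝟘
    fromBool-⇒ false true  = 𝟘⇒𝟙≡𝟘
    fromBool-⇒ true  false = ⇒-identityˡ 𝟘
    fromBool-⇒ true  true  = sh3 𝟙

    ⟦⟧-fromBool : ∀ t {ρ β} → (∀ j → ρ j ≡ fromBool (β j)) →
                  ⟦ A ⟧ t ρ ≡ fromBool (⟦ TwoBar ⟧ t β)
    ⟦⟧-fromBool (var i) ρ≡β    = ρ≡β i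
    ⟦⟧-fromBool `0 ρ≡β         = refl
    ⟦⟧-fromBool `1 ρ≡β         = refl
    ⟦⟧-fromBool (s `∧ t) {β = β} ρ≡β =
      trans (cong₂ _⊓_ (⟦⟧-fromBool s ρ≡β) (⟦⟧-fromBool t ρ≡β)) (fromBool-⊓ (⟦ TwoBar ⟧ s β) _)
    ⟦⟧-fromBool (s `∨ t) {β = β} ρ≡β =
      trans (cong₂ _⊔'_ (⟦⟧-fromBool s ρ≡β) (⟦⟧-fromBool t ρ≡β)) (fromBool-⊔ (⟦ TwoBar ⟧ s β) _)
    ⟦⟧-fromBool (s `→ t) {β = β} ρ≡β =
      trans (cong₂ _⇒_ (⟦⟧-fromBool s ρ≡β) (⟦⟧-fromBool t ρ≡β)) (fromBool-⇒ (⟦ TwoBar ⟧ s β) _)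

  BooleanFrom : ℕ → (ℕ → Carrier) → Set ℓ
  BooleanFrom k ρ = ∀ j → k ≤ₙ j → Σ Bool λ b → ρ j ≡ fromBool b

  BooleanFrom-update : ∀ {k ρ} → BooleanFrom (suc k) ρ → ∀ b → BooleanFrom k (ρ [ k ≔ fromBool b ])
  BooleanFrom-update {k} boolean b j k≤j with j ≟ k
  ... | yes _   = b , refl
  ... | no  j≢k = boolean j (≤∧≢⇒< k≤j (λ k≡j → j≢k (sym k≡j)))

  _↾_ : (ℕ → Carrier) → ℕ → ℕ → Carrier
  (ρ ↾ n) j with j <? n
  ... | yes _ = ρ j
  ... | no  _ = 𝟘

  ↾-agrees : ∀ ρ {n j} → j < n → ρ j ≡ (ρ ↾ n) j
  ↾-agrees ρ {n} {j} j<n with j <? n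
  ... | yes _   = refl
  ... | no  j≮n = ⊥-elim (j≮n j<n)

  ↾-BooleanFrom : ∀ ρ n → BooleanFrom n (ρ ↾ n)
  ↾-BooleanFrom ρ n j n≤j with j <? n
  ... | yes j<n = ⊥-elim (<⇒≱ j<n n≤j)
  ... | no  _   = false , refl

  module _ (complemented : ∀ x → x ⊔' x * ≡ 𝟙) (𝟘⇒𝟙≡𝟘 : 𝟘 ⇒ 𝟙 ≡ 𝟘)
           (s t : Term) (s≈t : TwoBar ⊨ s ≈ t) where

    ⊨-BooleanFrom : ∀ k ρ → BooleanFrom k ρ → ⟦ A ⟧ s ρ ≡ ⟦ A ⟧ t ρ
    ⊨-BooleanFrom zero ρ boolean = begin
      ⟦ A ⟧ s ρ                  ≡⟨ ⟦⟧-fromBool 𝟘⇒𝟙≡𝟘 s ρ≡β ⟩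
      fromBool (⟦ TwoBar ⟧ s β)  ≡⟨ cong fromBool (s≈t β) ⟩
      fromBool (⟦ TwoBar ⟧ t β)  ≡⟨ sym (⟦⟧-fromBool 𝟘⇒𝟙≡𝟘 t ρ≡β) ⟩
      ⟦ A ⟧ t ρ                  ∎
      where
      open ≡-Reasoning
      β : ℕ → Bool
      β j = proj₁ (boolean j z≤n)
      ρ≡β : ∀ j → ρ j ≡ fromBool (β j)
      ρ≡β j = proj₂ (boolean j z≤n)
    -- Below ρ k the variable k can be set to 𝟙, below ρ k * to 𝟘, and these cover 𝟙.
    ⊨-BooleanFrom (suc k) ρ boolean =
      ≡-by-cases (complemented (ρ k))
        (below (ρ k) true (x≡[x]𝟙 (ρ k)))
        (below (ρ k *) false (x≡[x*]𝟘 (ρ k)))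
      where
      open ≡-Reasoning
      below : ∀ a b → ρ k ≡[ a ] fromBool b → ⟦ A ⟧ s ρ ≡[ a ] ⟦ A ⟧ t ρ
      below a b ρk≡[a]b = begin
        a ⊓ ⟦ A ⟧ s ρ   ≡⟨ ⟦⟧-cong-≡[] a s (λ j _ → ≡[]-update ρk≡[a]b j) ⟩
        a ⊓ ⟦ A ⟧ s ρ'  ≡⟨ cong (a ⊓_) (⊨-BooleanFrom k ρ' (BooleanFrom-update boolean b)) ⟩
        a ⊓ ⟦ A ⟧ t ρ'  ≡⟨ sym (⟦⟧-cong-≡[] a t (λ j _ → ≡[]-update ρk≡[a]b j)) ⟩
        a ⊓ ⟦ A ⟧ t ρ   ∎
        where
        ρ' : ℕ → Carrier
        ρ' = ρ [ k ≔ fromBool b ]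

  complemented⇒InV2̄ : (∀ x → x ⊔' x * ≡ 𝟙) → 𝟘 ⇒ 𝟙 ≡ 𝟘 → InV2̄ A
  complemented⇒InV2̄ complemented 𝟘⇒𝟙≡𝟘 s t s≈t ρ = begin
    ⟦ A ⟧ s ρ        ≡⟨ ⟦⟧-cong s (λ j j<s → ↾-agrees ρ (m<n⇒m<n⊔o (varBound t) j<s)) ⟩
    ⟦ A ⟧ s (ρ ↾ n)  ≡⟨ ⊨-BooleanFrom complemented 𝟘⇒𝟙≡𝟘 s t s≈t n (ρ ↾ n) (↾-BooleanFrom ρ n) ⟩
    ⟦ A ⟧ t (ρ ↾ n)  ≡⟨ sym (⟦⟧-cong t (λ j j<t → ↾-agrees ρ (m<n⇒m<o⊔n (varBound s) j<t))) ⟩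
    ⟦ A ⟧ t ρ        ∎
    where
    open ≡-Reasoning
    n : ℕ
    n = varBound s ⊔ₙ varBound t

  SHc⇒𝟘⇒𝟙≡𝟘 : SHc A → 𝟘 ⇒ 𝟙 ≡ 𝟘
  SHc⇒𝟘⇒𝟙≡𝟘 shc = trans (shc 𝟘 𝟙) (⇒-identityˡ 𝟘)

  module _ (bt1 : BT1 A) (shc : SHc A) where

    *≡𝟘⇒≡𝟙 : ∀ {d} → d * ≡ 𝟘 → d ≡ 𝟙
    *≡𝟘⇒≡𝟙 {d} d*≡𝟘 = begin
      d                          ≡⟨ sym (⇒-identityˡ d) ⟩
      𝟙 ⇒ d                      ≡⟨ shc 𝟙 d ⟩
      d ⇒ 𝟙                      ≡⟨ cong (d ⇒_) (sym (sh3 𝟘)) ⟩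
      d ⇒ 𝟘 *                    ≡⟨ cong (λ z → d ⇒ z *) (sym d*≡𝟘) ⟩
      d ⇒ d * *                  ≡⟨ cong₂ (λ u v → u ⇒ v *) (sym (⇒-identityˡ d)) (sym (⇒-identityˡ (d *))) ⟩
      (𝟙 ⇒ d) ⇒ (𝟙 ⇒ d *) *      ≡⟨ bt1 𝟙 d ⟩
      𝟙                          ∎
      where open ≡-Reasoning

    BT1∩SHc⇒complemented : ∀ x → x ⊔' x * ≡ 𝟙
    BT1∩SHc⇒complemented x = *≡𝟘⇒≡𝟙 ([x⊔x*]*≡𝟘 x)

    BT1∩SHc⇒InV2̄ : InV2̄ A
    BT1∩SHc⇒InV2̄ = complemented⇒InV2̄ BT1∩SHc⇒complemented (SHc⇒𝟘⇒𝟙≡𝟘 shc)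

BT1-TwoBar : BT1 TwoBar
BT1-TwoBar false false = refl
BT1-TwoBar false true  = refl
BT1-TwoBar true  false = refl
BT1-TwoBar true  true  = refl

SHc-TwoBar : SHc TwoBar
SHc-TwoBar false false = refl
SHc-TwoBar false true  = refl
SHc-TwoBar true  false = refl
SHc-TwoBar true  true  = refl

module _ {ℓ : Level} (A : SemiHeyting ℓ) (inV2̄ : InV2̄ A) where
  open SemiHeyting A using (Carrier)

  private
    x₀ x₁ : Term
    x₀ = var 0
    x₁ = var 1

    env : Carrier → Carrier → ℕ → Carrier
    env x y zero    = x
    env x y (suc _) = y

  InV2̄⇒BT1 : BT1 A
  InV2̄⇒BT1 x y = inV2̄ ((x₀ `→ x₁) `→ ((x₀ `→ (x₁ `→ `0)) `→ `0)) `1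
    (λ β → BT1-TwoBar (β 0) (β 1)) (env x y)

  InV2̄⇒SHc : SHc A
  InV2̄⇒SHc x y = inV2̄ (x₀ `→ x₁) (x₁ `→ x₀) (λ β → SHc-TwoBar (β 0) (β 1)) (env x y)

corollary7p7 : ∀ {ℓ} (A : SemiHeyting ℓ) → (BT1 A × SHc A) ⇔ InV2̄ A
corollary7p7 A = mk⇔
  (λ (bt1 , shc) → BT1∩SHc⇒InV2̄ bt1 shc)
  (λ inV2̄ → InV2̄⇒BT1 A inV2̄ , InV2̄⇒SHc A inV2̄)
  where open SemiHeytingProperties A
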